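{- For every integer $n \geq 1$, $$B_n = -\sum_{k=1}^{n} \frac{n}{k}\, S(n-1,k-1)\, B_k^*.$$
   Context: The Stirling numbers of the second kind $S(n,k)$ ($n,k\ge 0$) are defined by $X^n = \sum_{k=0}^{n} S(n,k) X^{\underline{k}}$, where $X^{\underline{k}} := X(X-1)\cdots(X-k+1)$, with $S(n,k)=0$ for $n<k$. The Bernoulli numbers (of the first kind) $B_n$ are defined by $\frac{t}{e^t-1} = \sum_{n\ge 0} B_n \frac{t^n}{n!}$. The Bernoulli numbers of the second kind $B_n^*$ are defined by $\frac{t}{\log(1+t)} = \sum_{n\ge 0} B_n^* \frac{t^n}{n!}$ (equivalently $B_n^* = \int_0^1 x^{\underline{n}}\,dx$). -}

module Defs where

open import Data.Nat using (ℕ; zero; suc; _!; _∸_) renaming (_<_ to _<ℕ_)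
open import Data.Product using (_×_)
open import Relation.Binary.PropositionalEquality using (_≡_)
open import Data.Nat.Properties using (_!≢0)
open import Data.Integer using (+_; -[1+_])
open import Data.Rational using (ℚ; 0ℚ; 1ℚ; _+_; _*_; _-_; _/_)

Σ< : ℕ → (ℕ → ℚ) → ℚ
Σ< zero    f = 0ℚ
Σ< (suc n) f = Σ< n f + f n

ι : ℕ → ℚ
ι n = (+ n) / 1

_^_ : ℚ → ℕ → ℚ
x ^ zero  = 1ℚ
x ^ suc n = x * (x ^ n)

fall : ℚ → ℕ → ℚ
fall x zero    = 1ℚ
fall x (suc k) = fall x k * (x - ι k)

PowerSeries : Set
PowerSeries = ℕ → ℚ

_⊛_ : PowerSeries → PowerSeries → PowerSeries
(f ⊛ g) n = Σ< (suc n) (λ i → f i * g (n ∸ i))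

one : PowerSeries
one zero    = 1ℚ
one (suc n) = 0ℚ

egf : (ℕ → ℚ) → PowerSeries
egf a n = a n * ((+ 1) / (n !)) {{n !≢0}}

expm1/t : PowerSeries
expm1/t m = ((+ 1) / (suc m !)) {{suc m !≢0}}

log1p/t : PowerSeries
log1p/t zero    = 1ℚ
log1p/t (suc m) = ((-[1+ 0 ] / 1) ^ suc m) * ((+ 1) / suc (suc m))
-- B is the sequence of Bernoulli numbers: t/(e^t-1) = Σ B_n t^n/n!,
-- i.e. (Σ B_n t^n/n!) · ((e^t-1)/t) = 1 as formal power series
IsBernoulli : (ℕ → ℚ) → Set
IsBernoulli B = ∀ n → (egf B ⊛ expm1/t) n ≡ one n

-- B* is the sequence of Bernoulli numbers of the second kind:
-- t/log(1+t) = Σ B*_n t^n/n!, i.e. (Σ B*_n t^n/n!) · (log(1+t)/t) = 1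
IsBernoulli₂ : (ℕ → ℚ) → Set
IsBernoulli₂ B* = ∀ n → (egf B* ⊛ log1p/t) n ≡ one n

IsStirling₂ : (ℕ → ℕ → ℚ) → Set
IsStirling₂ S =
  (∀ n (x : ℚ) → x ^ n ≡ Σ< (suc n) (λ k → S n k * fall x k))
  × (∀ n k → n <ℕ k → S n k ≡ 0ℚ)

-- Composition with e^t − 1 is a ring homomorphism of formal power series.  Since k! S(n,k)/n!
-- are the coefficients of (e^t − 1)^k, and Σₖ (−1)^k k! S(n+1,k+1) = [n = 0] (the Stirling
-- recurrence telescopes), it sends log(1+t) to t.  Applied to (t/log(1+t))·(log(1+t)/t) = 1
-- it gives Σₖ B*ₖ (e^t − 1)^k/k! = (e^t − 1)/t.  Splitting off the constant term, this reads
-- (e^t − 1)/t = 1 + (e^t − 1)·R with R = Σₖ B*ₖ₊₁ (e^t − 1)^k/(k+1)!, so multiplying by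
-- t/(e^t − 1) gives t/(e^t − 1) + t·R = 1; the coefficient of tⁿ in t·R is the sum in question.
{-# OPTIONS --safe #-}
module Submission where

open import Defs
open import Data.Nat using (ℕ; suc; _≥_; _∸_)
open import Data.Integer using (+_; -[1+_])
open import Data.Rational using (ℚ; -_; _*_; _/_)
open import Relation.Binary.PropositionalEquality using (_≡_)

open import Algebra.Bundles using (Ring)
import Algebra.Properties.Monoid.Mult as MonoidMult
import Algebra.Properties.Semiring.Mult as SemiringMult
open import Data.Nat as ℕ using (zero; _!; _≤_; _<_; z≤n; s≤s; NonZero)
open import Data.Nat.Induction using (<-rec)
import Data.Nat.Properties as ℕₚ
open import Data.Nat.Properties using (_!≢0)
import Data.Integer.Solver as ℤ-Solver
open import Data.Product using (proj₁; proj₂)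
open import Data.Rational using (0ℚ; 1ℚ; _+_; _-_; toℚᵘ)
import Data.Rational.Properties as ℚₚ
open import Data.Rational.Solver using (module +-*-Solver)
open import Data.Rational.Unnormalised as ℚᵘ using (mkℚᵘ; *≡*)
import Data.Rational.Unnormalised.Properties as ℚᵘₚ
open import Data.Sum using (inj₁; inj₂)
open import Relation.Binary.PropositionalEquality
  using (refl; sym; trans; cong; cong₂; _≗_; _→-setoid_; module ≡-Reasoning)
import Relation.Binary.Reasoning.Setoid as SetoidReasoning
open import Relation.Nullary using (yes; no; contradiction)

open import Algebra.Properties.Group ℚₚ.+-0-group using (x∙y⁻¹≈ε⇒x≈y; inverseˡ-unique)
open MonoidMult ℚₚ.+-0-monoid using (_×_; ×-homo-+)
open SemiringMult (Ring.semiring ℚₚ.+-*-ring) using (×1-homo-*)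

toℚᵘ-/ : ∀ i d → toℚᵘ (i / suc d) ℚᵘ.≃ mkℚᵘ i d
toℚᵘ-/ i d = ℚₚ.toℚᵘ-fromℚᵘ (mkℚᵘ i d)

-- Normalisation in ℚ goes through gcd, which is stuck on variables, so these are proved in ℚᵘ.
module _ where
  open ℚᵘₚ.≃-Reasoning
  open ℤ-Solver.+-*-Solver

  ι-suc : ∀ n → ι (suc n) ≡ 1ℚ + ι n
  ι-suc n = ℚₚ.toℚᵘ-injective (begin
    toℚᵘ (ι (suc n))                 ≈⟨ toℚᵘ-/ (+ suc n) 0 ⟩
    mkℚᵘ (+ suc n) 0                 ≈⟨ *≡* (solve 1 (λ x → (con (+ 1) :+ x) :* con (+ 1)
                                                       := (con (+ 1) :* con (+ 1) :+ x :* con (+ 1)) :* con (+ 1))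
                                                  refl (+ n)) ⟩
    mkℚᵘ (+ 1) 0 ℚᵘ.+ mkℚᵘ (+ n) 0   ≈⟨ ℚᵘₚ.+-cong (toℚᵘ-/ (+ 1) 0) (toℚᵘ-/ (+ n) 0) ⟨
    toℚᵘ 1ℚ ℚᵘ.+ toℚᵘ (ι n)          ≈⟨ ℚₚ.toℚᵘ-homo-+ 1ℚ (ι n) ⟨
    toℚᵘ (1ℚ + ι n)                  ∎)

  ι[n]*1/n≡1 : ∀ n .{{_ : NonZero n}} → ι n * ((+ 1) / n) ≡ 1ℚ
  ι[n]*1/n≡1 (suc n) = ℚₚ.toℚᵘ-injective (begin
    toℚᵘ (ι (suc n) * ((+ 1) / suc n))           ≈⟨ ℚₚ.toℚᵘ-homo-* (ι (suc n)) ((+ 1) / suc n) ⟩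
    toℚᵘ (ι (suc n)) ℚᵘ.* toℚᵘ ((+ 1) / suc n)  ≈⟨ ℚᵘₚ.*-cong (toℚᵘ-/ (+ suc n) 0) (toℚᵘ-/ (+ 1) n) ⟩
    mkℚᵘ (+ suc n) 0 ℚᵘ.* mkℚᵘ (+ 1) n          ≈⟨ *≡* (solve 1 (λ x → x :* con (+ 1) :* con (+ 1)
                                                                   := con (+ 1) :* (con (+ 1) :* x))
                                                              refl (+ suc n)) ⟩
    toℚᵘ 1ℚ                                      ∎)

  +a/n≡ι[a]*1/n : ∀ a n → (+ a) / suc n ≡ ι a * ((+ 1) / suc n)
  +a/n≡ι[a]*1/n a n = ℚₚ.toℚᵘ-injective (begin
    toℚᵘ ((+ a) / suc n)                     ≈⟨ toℚᵘ-/ (+ a) n ⟩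
    mkℚᵘ (+ a) n                             ≈⟨ *≡* (solve 2 (λ x y → x :* (con (+ 1) :* y)
                                                                   := x :* con (+ 1) :* y)
                                                          refl (+ a) (+ suc n)) ⟩
    mkℚᵘ (+ a) 0 ℚᵘ.* mkℚᵘ (+ 1) n           ≈⟨ ℚᵘₚ.*-cong (toℚᵘ-/ (+ a) 0) (toℚᵘ-/ (+ 1) n) ⟨
    toℚᵘ (ι a) ℚᵘ.* toℚᵘ ((+ 1) / suc n)     ≈⟨ ℚₚ.toℚᵘ-homo-* (ι a) ((+ 1) / suc n) ⟨
    toℚᵘ (ι a * ((+ 1) / suc n))             ∎)

open +-*-Solver using (solve; _:=_; _:+_; _:*_; :-_; _:-_; con)

ι≡×1 : ∀ n → ι n ≡ n × 1ℚ
ι≡×1 zero    = refl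
ι≡×1 (suc n) = trans (ι-suc n) (cong (_+_ 1ℚ) (ι≡×1 n))

ι-homo-+ : ∀ m n → ι (m ℕ.+ n) ≡ ι m + ι n
ι-homo-+ m n = begin
  ι (m ℕ.+ n)          ≡⟨ ι≡×1 (m ℕ.+ n) ⟩
  (m ℕ.+ n) × 1ℚ       ≡⟨ ×-homo-+ 1ℚ m n ⟩
  m × 1ℚ + n × 1ℚ      ≡⟨ cong₂ _+_ (ι≡×1 m) (ι≡×1 n) ⟨
  ι m + ι n            ∎
  where open ≡-Reasoning

ι-homo-* : ∀ m n → ι (m ℕ.* n) ≡ ι m * ι n
ι-homo-* m n = begin
  ι (m ℕ.* n)          ≡⟨ ι≡×1 (m ℕ.* n) ⟩
  (m ℕ.* n) × 1ℚ       ≡⟨ ×1-homo-* m n ⟩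
  m × 1ℚ * (n × 1ℚ)    ≡⟨ cong₂ _*_ (ι≡×1 m) (ι≡×1 n) ⟨
  ι m * ι n            ∎
  where open ≡-Reasoning

*-cancelʳ-ι : ∀ n .{{_ : NonZero n}} {p q : ℚ} → p * ι n ≡ q * ι n → p ≡ q
*-cancelʳ-ι n {p} {q} eq = begin
  p                          ≡⟨ ℚₚ.*-identityʳ p ⟨
  p * 1ℚ                     ≡⟨ cong (p *_) (ι[n]*1/n≡1 n) ⟨
  p * (ι n * ((+ 1) / n))    ≡⟨ ℚₚ.*-assoc p (ι n) _ ⟨
  p * ι n * ((+ 1) / n)      ≡⟨ cong (_* ((+ 1) / n)) eq ⟩
  q * ι n * ((+ 1) / n)      ≡⟨ ℚₚ.*-assoc q (ι n) _ ⟩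
  q * (ι n * ((+ 1) / n))    ≡⟨ cong (q *_) (ι[n]*1/n≡1 n) ⟩
  q * 1ℚ                     ≡⟨ ℚₚ.*-identityʳ q ⟩
  q                          ∎
  where open ≡-Reasoning

1/_! : ℕ → ℚ
1/ n ! = ((+ 1) / (n !)) {{n !≢0}}

ι[n!]*1/n!≡1 : ∀ n → ι (n !) * 1/ n ! ≡ 1ℚ
ι[n!]*1/n!≡1 n = ι[n]*1/n≡1 (n !) {{n !≢0}}

ι[1+n]*1/[1+n]!≡1/n! : ∀ n → ι (suc n) * 1/ suc n ! ≡ 1/ n !
ι[1+n]*1/[1+n]!≡1/n! n = *-cancelʳ-ι (n !) {{n !≢0}} (begin
  ι (suc n) * 1/ suc n ! * ι (n !)   ≡⟨ solve 3 (λ a b c → a :* b :* c := a :* c :* b)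
                                               refl (ι (suc n)) (1/ suc n !) (ι (n !)) ⟩
  ι (suc n) * ι (n !) * 1/ suc n !   ≡⟨ cong (_* 1/ suc n !) (ι-homo-* (suc n) (n !)) ⟨
  ι (suc n !) * 1/ suc n !           ≡⟨ ι[n!]*1/n!≡1 (suc n) ⟩
  1ℚ                                 ≡⟨ ι[n!]*1/n!≡1 n ⟨
  ι (n !) * 1/ n !                   ≡⟨ ℚₚ.*-comm (ι (n !)) (1/ n !) ⟩
  1/ n ! * ι (n !)                   ∎)
  where open ≡-Reasoning

1/[1+k]!*ι[k!]≡1/[1+k] : ∀ k → 1/ suc k ! * ι (k !) ≡ (+ 1) / suc k
1/[1+k]!*ι[k!]≡1/[1+k] k = *-cancelʳ-ι (suc k) (begin
  1/ suc k ! * ι (k !) * ι (suc k)   ≡⟨ solve 3 (λ a b c → a :* b :* c := c :* b :* a)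
                                               refl (1/ suc k !) (ι (k !)) (ι (suc k)) ⟩
  ι (suc k) * ι (k !) * 1/ suc k !   ≡⟨ cong (_* 1/ suc k !) (ι-homo-* (suc k) (k !)) ⟨
  ι (suc k !) * 1/ suc k !           ≡⟨ ι[n!]*1/n!≡1 (suc k) ⟩
  1ℚ                                 ≡⟨ ι[n]*1/n≡1 (suc k) ⟨
  ι (suc k) * ((+ 1) / suc k)        ≡⟨ ℚₚ.*-comm (ι (suc k)) _ ⟩
  (+ 1) / suc k * ι (suc k)          ∎)
  where open ≡-Reasoning

1/m!*ι[[1+m]!]≡ι[1+m] : ∀ m → 1/ m ! * ι (suc m !) ≡ ι (suc m)
1/m!*ι[[1+m]!]≡ι[1+m] m = begin
  1/ m ! * ι (suc m !)               ≡⟨ cong (1/ m ! *_) (ι-homo-* (suc m) (m !)) ⟩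
  1/ m ! * (ι (suc m) * ι (m !))     ≡⟨ solve 3 (λ f a b → f :* (a :* b) := a :* (b :* f))
                                               refl (1/ m !) (ι (suc m)) (ι (m !)) ⟩
  ι (suc m) * (ι (m !) * 1/ m !)     ≡⟨ cong (ι (suc m) *_) (ι[n!]*1/n!≡1 m) ⟩
  ι (suc m) * 1ℚ                     ≡⟨ ℚₚ.*-identityʳ (ι (suc m)) ⟩
  ι (suc m)                          ∎
  where open ≡-Reasoning

egf[a]n*ι[n!]≡a[n] : ∀ a n → egf a n * ι (n !) ≡ a n
egf[a]n*ι[n!]≡a[n] a n = begin
  a n * 1/ n ! * ι (n !)     ≡⟨ ℚₚ.*-assoc (a n) _ _ ⟩
  a n * (1/ n ! * ι (n !))   ≡⟨ cong (a n *_) (trans (ℚₚ.*-comm (1/ n !) (ι (n !))) (ι[n!]*1/n!≡1 n)) ⟩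
  a n * 1ℚ                   ≡⟨ ℚₚ.*-identityʳ (a n) ⟩
  a n                        ∎
  where open ≡-Reasoning

Σ<-cong-< : ∀ n {f g : ℕ → ℚ} → (∀ i → i < n → f i ≡ g i) → Σ< n f ≡ Σ< n g
Σ<-cong-< zero    eq = refl
Σ<-cong-< (suc n) eq =
  cong₂ _+_ (Σ<-cong-< n (λ i i<n → eq i (ℕₚ.m<n⇒m<1+n i<n))) (eq n (ℕₚ.n<1+n n))

Σ<-cong : ∀ n {f g : ℕ → ℚ} → f ≗ g → Σ< n f ≡ Σ< n g
Σ<-cong n eq = Σ<-cong-< n (λ i _ → eq i)

Σ<-zero : ∀ n {f : ℕ → ℚ} → (∀ i → i < n → f i ≡ 0ℚ) → Σ< n f ≡ 0ℚ
Σ<-zero zero    eq = refl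
Σ<-zero (suc n) eq =
  cong₂ _+_ (Σ<-zero n (λ i i<n → eq i (ℕₚ.m<n⇒m<1+n i<n))) (eq n (ℕₚ.n<1+n n))

Σ<-distrib-+ : ∀ n (f g : ℕ → ℚ) → Σ< n (λ i → f i + g i) ≡ Σ< n f + Σ< n g
Σ<-distrib-+ zero    f g = refl
Σ<-distrib-+ (suc n) f g = begin
  Σ< n (λ i → f i + g i) + (f n + g n)   ≡⟨ cong (_+ (f n + g n)) (Σ<-distrib-+ n f g) ⟩
  (Σ< n f + Σ< n g) + (f n + g n)        ≡⟨ solve 4 (λ a b c d → (a :+ b) :+ (c :+ d) := (a :+ c) :+ (b :+ d))
                                                  refl (Σ< n f) (Σ< n g) (f n) (g n) ⟩
  (Σ< n f + f n) + (Σ< n g + g n)        ∎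
  where open ≡-Reasoning

Σ<-distrib-- : ∀ n (f g : ℕ → ℚ) → Σ< n (λ i → f i - g i) ≡ Σ< n f - Σ< n g
Σ<-distrib-- zero    f g = refl
Σ<-distrib-- (suc n) f g = begin
  Σ< n (λ i → f i - g i) + (f n - g n)   ≡⟨ cong (_+ (f n - g n)) (Σ<-distrib-- n f g) ⟩
  (Σ< n f - Σ< n g) + (f n - g n)        ≡⟨ solve 4 (λ a b c d → (a :- b) :+ (c :- d) := (a :+ c) :- (b :+ d))
                                                  refl (Σ< n f) (Σ< n g) (f n) (g n) ⟩
  (Σ< n f + f n) - (Σ< n g + g n)        ∎
  where open ≡-Reasoning

Σ<-distribˡ-* : ∀ n c (f : ℕ → ℚ) → c * Σ< n f ≡ Σ< n (λ i → c * f i)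
Σ<-distribˡ-* zero    c f = ℚₚ.*-zeroʳ c
Σ<-distribˡ-* (suc n) c f =
  trans (ℚₚ.*-distribˡ-+ c (Σ< n f) (f n)) (cong (_+ c * f n) (Σ<-distribˡ-* n c f))

Σ<-distribʳ-* : ∀ n c (f : ℕ → ℚ) → Σ< n f * c ≡ Σ< n (λ i → f i * c)
Σ<-distribʳ-* n c f = begin
  Σ< n f * c             ≡⟨ ℚₚ.*-comm (Σ< n f) c ⟩
  c * Σ< n f             ≡⟨ Σ<-distribˡ-* n c f ⟩
  Σ< n (λ i → c * f i)   ≡⟨ Σ<-cong n (λ i → ℚₚ.*-comm c (f i)) ⟩
  Σ< n (λ i → f i * c)   ∎
  where open ≡-Reasoning

Σ<-*-Σ< : ∀ m n (f g : ℕ → ℚ) → Σ< m f * Σ< n g ≡ Σ< m (λ i → Σ< n (λ j → f i * g j))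
Σ<-*-Σ< m n f g = trans (Σ<-distribʳ-* m (Σ< n g) f) (Σ<-cong m (λ i → Σ<-distribˡ-* n (f i) g))

Σ<-head : ∀ n (f : ℕ → ℚ) → Σ< (suc n) f ≡ f 0 + Σ< n (λ i → f (suc i))
Σ<-head zero    f = ℚₚ.+-comm 0ℚ (f 0)
Σ<-head (suc n) f = begin
  Σ< (suc n) f + f (suc n)                     ≡⟨ cong (_+ f (suc n)) (Σ<-head n f) ⟩
  (f 0 + Σ< n (λ i → f (suc i))) + f (suc n)   ≡⟨ ℚₚ.+-assoc (f 0) _ _ ⟩
  f 0 + Σ< (suc n) (λ i → f (suc i))           ∎
  where open ≡-Reasoning

Σ<-head-only : ∀ n {f : ℕ → ℚ} → (∀ i → f (suc i) ≡ 0ℚ) → Σ< (suc n) f ≡ f 0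
Σ<-head-only n {f} tail≡0 = begin
  Σ< (suc n) f                   ≡⟨ Σ<-head n f ⟩
  f 0 + Σ< n (λ i → f (suc i))   ≡⟨ cong (_+_ (f 0)) (Σ<-zero n (λ i _ → tail≡0 i)) ⟩
  f 0 + 0ℚ                       ≡⟨ ℚₚ.+-identityʳ (f 0) ⟩
  f 0                            ∎
  where open ≡-Reasoning

Σ<-reverse : ∀ n (f : ℕ → ℚ) → Σ< (suc n) f ≡ Σ< (suc n) (λ i → f (n ∸ i))
Σ<-reverse zero    f = refl
Σ<-reverse (suc n) f = begin
  Σ< (suc n) f + f (suc n)                   ≡⟨ cong (_+ f (suc n)) (Σ<-reverse n f) ⟩
  Σ< (suc n) (λ i → f (n ∸ i)) + f (suc n)   ≡⟨ ℚₚ.+-comm _ (f (suc n)) ⟩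
  f (suc n) + Σ< (suc n) (λ i → f (n ∸ i))   ≡⟨ Σ<-head (suc n) (λ i → f (suc n ∸ i)) ⟨
  Σ< (suc (suc n)) (λ i → f (suc n ∸ i))     ∎
  where open ≡-Reasoning

Σ<-swap : ∀ m n (f : ℕ → ℕ → ℚ) →
          Σ< m (λ i → Σ< n (f i)) ≡ Σ< n (λ j → Σ< m (λ i → f i j))
Σ<-swap zero    n f = sym (Σ<-zero n (λ _ _ → refl))
Σ<-swap (suc m) n f = begin
  Σ< m (λ i → Σ< n (f i)) + Σ< n (f m)           ≡⟨ cong (_+ Σ< n (f m)) (Σ<-swap m n f) ⟩
  Σ< n (λ j → Σ< m (λ i → f i j)) + Σ< n (f m)   ≡⟨ Σ<-distrib-+ n _ _ ⟨
  Σ< n (λ j → Σ< (suc m) (λ i → f i j))          ∎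
  where open ≡-Reasoning

Σ<-extend : ∀ {m n} (f : ℕ → ℚ) → m ≤ n → (∀ i → m ≤ i → f i ≡ 0ℚ) →
            Σ< n f ≡ Σ< m f
Σ<-extend {m} f m≤n vanish = go (ℕₚ.≤⇒≤′ m≤n)
  where
  open ≡-Reasoning
  go : ∀ {n} → m ℕ.≤′ n → Σ< n f ≡ Σ< m f
  go ℕ.≤′-refl                = refl
  go {suc n} (ℕ.≤′-step m≤′n) = begin
    Σ< n f + f n   ≡⟨ cong₂ _+_ (go m≤′n) (vanish n (ℕₚ.≤′⇒≤ m≤′n)) ⟩
    Σ< m f + 0ℚ    ≡⟨ ℚₚ.+-identityʳ _ ⟩
    Σ< m f         ∎

Σ<-triangle : ∀ n (f : ℕ → ℕ → ℚ) →
              Σ< n (λ k → Σ< (suc k) (λ i → f i (k ∸ i))) ≡ Σ< n (λ i → Σ< (n ∸ i) (f i))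
Σ<-triangle zero    f = refl
Σ<-triangle (suc n) f = begin
  Σ< n (λ k → Σ< (suc k) (λ i → f i (k ∸ i))) + diagonal
    ≡⟨ cong (_+ diagonal) (Σ<-triangle n f) ⟩
  Σ< n (λ i → Σ< (n ∸ i) (f i)) + diagonal
    ≡⟨ cong (_+ diagonal) lastRowEmpty ⟨
  Σ< (suc n) (λ i → Σ< (n ∸ i) (f i)) + diagonal
    ≡⟨ Σ<-distrib-+ (suc n) _ _ ⟨
  Σ< (suc n) (λ i → Σ< (suc (n ∸ i)) (f i))
    ≡⟨ Σ<-cong-< (suc n) (λ i i<1+n → cong (λ l → Σ< l (f i)) (ℕₚ.+-∸-assoc 1 (ℕₚ.≤-pred i<1+n))) ⟨
  Σ< (suc n) (λ i → Σ< (suc n ∸ i) (f i))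
    ∎
  where
  open ≡-Reasoning
  diagonal : ℚ
  diagonal = Σ< (suc n) (λ i → f i (n ∸ i))
  lastRowEmpty : Σ< (suc n) (λ i → Σ< (n ∸ i) (f i)) ≡ Σ< n (λ i → Σ< (n ∸ i) (f i))
  lastRowEmpty = trans (cong (λ l → Σ< n (λ i → Σ< (n ∸ i) (f i)) + Σ< l (f n)) (ℕₚ.n∸n≡0 n))
                       (ℚₚ.+-identityʳ _)

Σ<-telescope : ∀ n (u : ℕ → ℚ) → Σ< n (λ k → u k - u (suc k)) ≡ u 0 - u n
Σ<-telescope zero    u = sym (ℚₚ.+-inverseʳ (u 0))
Σ<-telescope (suc n) u = begin
  Σ< n (λ k → u k - u (suc k)) + (u n - u (suc n))   ≡⟨ cong (_+ (u n - u (suc n))) (Σ<-telescope n u) ⟩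
  (u 0 - u n) + (u n - u (suc n))                    ≡⟨ solve 3 (λ a b c → (a :- b) :+ (b :- c) := a :- c)
                                                              refl (u 0) (u n) (u (suc n)) ⟩
  u 0 - u (suc n)                                    ∎
  where open ≡-Reasoning

fall-1+ : ∀ x k → fall (1ℚ + x) (suc k) ≡ (1ℚ + x) * fall x k
fall-1+ x zero    = solve 1 (λ y → con 1ℚ :* ((con 1ℚ :+ y) :- con 0ℚ) := (con 1ℚ :+ y) :* con 1ℚ) refl x
fall-1+ x (suc k) = begin
  fall (1ℚ + x) (suc k) * ((1ℚ + x) - ι (suc k))
    ≡⟨ cong₂ (λ p q → p * ((1ℚ + x) - q)) (fall-1+ x k) (ι-suc k) ⟩
  (1ℚ + x) * fall x k * ((1ℚ + x) - (1ℚ + ι k))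
    ≡⟨ solve 3 (λ y f i → (con 1ℚ :+ y) :* f :* ((con 1ℚ :+ y) :- (con 1ℚ :+ i))
                          := (con 1ℚ :+ y) :* (f :* (y :- i)))
             refl x (fall x k) (ι k) ⟩
  (1ℚ + x) * (fall x k * (x - ι k))
    ∎
  where open ≡-Reasoning

fall-ι-diagonal : ∀ k → fall (ι k) k ≡ ι (k !)
fall-ι-diagonal zero    = refl
fall-ι-diagonal (suc k) = begin
  fall (ι (suc k)) (suc k)    ≡⟨ cong (λ x → fall x (suc k)) (ι-suc k) ⟩
  fall (1ℚ + ι k) (suc k)     ≡⟨ fall-1+ (ι k) k ⟩
  (1ℚ + ι k) * fall (ι k) k   ≡⟨ cong₂ _*_ (sym (ι-suc k)) (fall-ι-diagonal k) ⟩
  ι (suc k) * ι (k !)         ≡⟨ ι-homo-* (suc k) (k !) ⟨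
  ι (suc k !)                 ∎
  where open ≡-Reasoning

fall-ι-vanish : ∀ k j → k < j → fall (ι k) j ≡ 0ℚ
fall-ι-vanish k (suc j) k<1+j with ℕₚ.m≤n⇒m<n∨m≡n (ℕₚ.≤-pred k<1+j)
... | inj₁ k<j  = trans (cong (_* (ι k - ι j)) (fall-ι-vanish k j k<j)) (ℚₚ.*-zeroˡ (ι k - ι j))
... | inj₂ refl = trans (cong (fall (ι k) k *_) (ℚₚ.+-inverseʳ (ι k))) (ℚₚ.*-zeroʳ (fall (ι k) k))

-- Evaluate at x = k: the terms j > k vanish, and the terms j < k by induction.
fall-coefficients-unique : ∀ N (d : ℕ → ℚ) → (∀ x → Σ< N (λ j → d j * fall x j) ≡ 0ℚ) →
                           ∀ k → k < N → d k ≡ 0ℚ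
fall-coefficients-unique N d Σ≡0 = <-rec (λ k → k < N → d k ≡ 0ℚ) step
  where
  step : ∀ k → (∀ {j} → j < k → j < N → d j ≡ 0ℚ) → k < N → d k ≡ 0ℚ
  step k ih k<N = *-cancelʳ-ι (k !) {{k !≢0}} (begin
    d k * ι (k !)                           ≡⟨ cong (d k *_) (fall-ι-diagonal k) ⟨
    d k * fall (ι k) k                      ≡⟨ ℚₚ.+-identityˡ _ ⟨
    0ℚ + d k * fall (ι k) k                 ≡⟨ cong (_+ d k * fall (ι k) k) (Σ<-zero k lower) ⟨
    Σ< (suc k) (λ j → d j * fall (ι k) j)   ≡⟨ Σ<-extend _ k<N upper ⟨
    Σ< N (λ j → d j * fall (ι k) j)         ≡⟨ Σ≡0 (ι k) ⟩
    0ℚ                                      ≡⟨ ℚₚ.*-zeroˡ (ι (k !)) ⟨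
    0ℚ * ι (k !)                            ∎)
    where
    open ≡-Reasoning
    lower : ∀ j → j < k → d j * fall (ι k) j ≡ 0ℚ
    lower j j<k = trans (cong (_* fall (ι k) j) (ih j<k (ℕₚ.<-trans j<k k<N))) (ℚₚ.*-zeroˡ (fall (ι k) j))
    upper : ∀ j → k < j → d j * fall (ι k) j ≡ 0ℚ
    upper j k<j = trans (cong (d j *_) (fall-ι-vanish k j k<j)) (ℚₚ.*-zeroʳ (d j))

infixl 6 _⊕_
infixr 7 _⊙_
infix  25 X·_

_⊕_ : PowerSeries → PowerSeries → PowerSeries
(f ⊕ g) n = f n + g n

_⊙_ : ℚ → PowerSeries → PowerSeries
(c ⊙ f) n = c * f n

X·_ : PowerSeries → PowerSeries
(X· f) zero    = 0ℚ
(X· f) (suc n) = f n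

_/X : PowerSeries → PowerSeries
(f /X) n = f (suc n)

∂ : PowerSeries → PowerSeries
∂ f n = ι (suc n) * f (suc n)

module ≗-Reasoning = SetoidReasoning (ℕ →-setoid ℚ)

⊕-cong : ∀ {f f′ g g′} → f ≗ f′ → g ≗ g′ → f ⊕ g ≗ f′ ⊕ g′
⊕-cong f≗f′ g≗g′ n = cong₂ _+_ (f≗f′ n) (g≗g′ n)

⊕-congˡ : ∀ {f g g′} → g ≗ g′ → f ⊕ g ≗ f ⊕ g′
⊕-congˡ {f} = ⊕-cong {f} {f} (λ _ → refl)

X·-cong : ∀ {f g} → f ≗ g → X· f ≗ X· g
X·-cong f≗g zero    = refl
X·-cong f≗g (suc n) = f≗g n

X·-injective : ∀ {f g} → X· f ≗ X· g → f ≗ g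
X·-injective X·f≗X·g n = X·f≗X·g (suc n)

⊛-cong : ∀ {f f′ g g′} → f ≗ f′ → g ≗ g′ → f ⊛ g ≗ f′ ⊛ g′
⊛-cong f≗f′ g≗g′ n = Σ<-cong (suc n) (λ i → cong₂ _*_ (f≗f′ i) (g≗g′ (n ∸ i)))

⊛-congˡ : ∀ {f g g′} → g ≗ g′ → f ⊛ g ≗ f ⊛ g′
⊛-congˡ {f} = ⊛-cong {f} {f} (λ _ → refl)

⊛-congʳ : ∀ {f f′ g} → f ≗ f′ → f ⊛ g ≗ f′ ⊛ g
⊛-congʳ {g = g} f≗f′ = ⊛-cong {g = g} {g} f≗f′ (λ _ → refl)

⊛-comm : ∀ f g → f ⊛ g ≗ g ⊛ f
⊛-comm f g n = trans (Σ<-reverse n _) (Σ<-cong-< (suc n) (λ i i<1+n → begin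
  f (n ∸ i) * g (n ∸ (n ∸ i))   ≡⟨ cong (λ j → f (n ∸ i) * g j) (ℕₚ.m∸[m∸n]≡n (ℕₚ.≤-pred i<1+n)) ⟩
  f (n ∸ i) * g i               ≡⟨ ℚₚ.*-comm (f (n ∸ i)) (g i) ⟩
  g i * f (n ∸ i)               ∎))
  where open ≡-Reasoning

⊛-identityʳ : ∀ f → f ⊛ one ≗ f
⊛-identityʳ f n = begin
  Σ< n (λ i → f i * one (n ∸ i)) + f n * one (n ∸ n)
    ≡⟨ cong₂ _+_ (Σ<-zero n offDiagonal) (cong (λ j → f n * one j) (ℕₚ.n∸n≡0 n)) ⟩
  0ℚ + f n * 1ℚ
    ≡⟨ solve 1 (λ x → con 0ℚ :+ x :* con 1ℚ := x) refl (f n) ⟩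
  f n
    ∎
  where
  open ≡-Reasoning
  offDiagonal : ∀ i → i < n → f i * one (n ∸ i) ≡ 0ℚ
  offDiagonal i i<n with n ∸ i | ℕₚ.m>n⇒m∸n≢0 i<n
  ... | zero  | n∸i≢0 = contradiction refl n∸i≢0
  ... | suc _ | _     = ℚₚ.*-zeroʳ (f i)

⊛-identityˡ : ∀ f → one ⊛ f ≗ f
⊛-identityˡ f n = trans (⊛-comm one f n) (⊛-identityʳ f n)

⊛-assoc : ∀ f g h → (f ⊛ g) ⊛ h ≗ f ⊛ (g ⊛ h)
⊛-assoc f g h n = begin
  Σ< (suc n) (λ k → Σ< (suc k) (λ i → f i * g (k ∸ i)) * h (n ∸ k))
    ≡⟨ Σ<-cong (suc n) (λ k → Σ<-distribʳ-* (suc k) (h (n ∸ k)) _) ⟩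
  Σ< (suc n) (λ k → Σ< (suc k) (λ i → f i * g (k ∸ i) * h (n ∸ k)))
    ≡⟨ Σ<-cong (suc n) (λ k → Σ<-cong-< (suc k) (λ i i<1+k →
         trans (ℚₚ.*-assoc (f i) _ _)
               (cong (λ j → f i * (g (k ∸ i) * h j)) (sym (∸-∸-cancel (ℕₚ.≤-pred i<1+k)))))) ⟩
  Σ< (suc n) (λ k → Σ< (suc k) (λ i → F i (k ∸ i)))
    ≡⟨ Σ<-triangle (suc n) F ⟩
  Σ< (suc n) (λ i → Σ< (suc n ∸ i) (F i))
    ≡⟨ Σ<-cong-< (suc n) (λ i i<1+n →
         trans (cong (λ l → Σ< l (F i)) (ℕₚ.+-∸-assoc 1 (ℕₚ.≤-pred i<1+n)))
               (sym (Σ<-distribˡ-* (suc (n ∸ i)) (f i) _))) ⟩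
  Σ< (suc n) (λ i → f i * Σ< (suc (n ∸ i)) (λ j → g j * h (n ∸ i ∸ j))) ∎
  where
  open ≡-Reasoning
  F : ℕ → ℕ → ℚ
  F i j = f i * (g j * h (n ∸ i ∸ j))
  ∸-∸-cancel : ∀ {i k} → i ≤ k → n ∸ i ∸ (k ∸ i) ≡ n ∸ k
  ∸-∸-cancel {i} {k} i≤k = trans (ℕₚ.∸-+-assoc n i (k ∸ i)) (cong (n ∸_) (ℕₚ.m+[n∸m]≡n i≤k))

⊛-distribˡ-⊕ : ∀ f g h → f ⊛ (g ⊕ h) ≗ f ⊛ g ⊕ f ⊛ h
⊛-distribˡ-⊕ f g h n =
  trans (Σ<-cong (suc n) (λ i → ℚₚ.*-distribˡ-+ (f i) (g (n ∸ i)) (h (n ∸ i)))) (Σ<-distrib-+ (suc n) _ _)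

⊛-distribʳ-⊕ : ∀ f g h → (f ⊕ g) ⊛ h ≗ f ⊛ h ⊕ g ⊛ h
⊛-distribʳ-⊕ f g h n = trans (⊛-comm (f ⊕ g) h n)
  (trans (⊛-distribˡ-⊕ h f g n) (cong₂ _+_ (⊛-comm h f n) (⊛-comm h g n)))

⊛-⊙ : ∀ f c g → f ⊛ (c ⊙ g) ≗ c ⊙ (f ⊛ g)
⊛-⊙ f c g n = trans (Σ<-cong (suc n) (λ i → solve 3 (λ x y z → x :* (z :* y) := z :* (x :* y))
                                                     refl (f i) (g (n ∸ i)) c))
                    (sym (Σ<-distribˡ-* (suc n) c _))

X·-⊛ : ∀ f g → X· f ⊛ g ≗ X· (f ⊛ g)
X·-⊛ f g zero    = solve 1 (λ x → con 0ℚ :+ con 0ℚ :* x := con 0ℚ) refl (g 0)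
X·-⊛ f g (suc n) = begin
  Σ< (suc (suc n)) (λ i → (X· f) i * g (suc n ∸ i))  ≡⟨ Σ<-head (suc n) _ ⟩
  0ℚ * g (suc n) + (f ⊛ g) n                         ≡⟨ solve 2 (λ x y → con 0ℚ :* x :+ y := y)
                                                                 refl (g (suc n)) ((f ⊛ g) n) ⟩
  (f ⊛ g) n                                          ∎
  where open ≡-Reasoning

⊛-X· : ∀ f g → f ⊛ X· g ≗ X· (f ⊛ g)
⊛-X· f g n = trans (⊛-comm f (X· g) n) (trans (X·-⊛ g f n) (X·-cong (⊛-comm g f) n))

one⊕X·/X : ∀ {f} → f 0 ≡ 1ℚ → f ≗ one ⊕ X· (f /X)
one⊕X·/X f₀≡1 zero    = f₀≡1
one⊕X·/X f₀≡1 (suc n) = sym (ℚₚ.+-identityˡ _)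

⊛-inverse-unique : ∀ {f g h} → f ⊛ h ≗ one → g ⊛ h ≗ one → f ≗ g
⊛-inverse-unique {f} {g} {h} fh≗1 gh≗1 = begin
  f                ≈⟨ ⊛-identityʳ f ⟨
  f ⊛ one          ≈⟨ ⊛-congˡ {f} (λ n → trans (⊛-comm h g n) (gh≗1 n)) ⟨
  f ⊛ (h ⊛ g)      ≈⟨ ⊛-assoc f h g ⟨
  (f ⊛ h) ⊛ g      ≈⟨ ⊛-congʳ {g = g} fh≗1 ⟩
  one ⊛ g          ≈⟨ ⊛-identityˡ g ⟩
  g                ∎
  where open ≗-Reasoning

∂-cong : ∀ {f g} → f ≗ g → ∂ f ≗ ∂ g
∂-cong f≗g n = cong (ι (suc n) *_) (f≗g (suc n))

∂-⊛ : ∀ f g → ∂ (f ⊛ g) ≗ ∂ f ⊛ g ⊕ f ⊛ ∂ g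
∂-⊛ f g m = begin
  ι (suc m) * Σ< (suc (suc m)) (λ i → f i * g (suc m ∸ i))
    ≡⟨ Σ<-distribˡ-* (suc (suc m)) (ι (suc m)) _ ⟩
  Σ< (suc (suc m)) (λ i → ι (suc m) * (f i * g (suc m ∸ i)))
    ≡⟨ Σ<-cong-< (suc (suc m)) splitWeight ⟩
  Σ< (suc (suc m)) (λ i → left i + right i)
    ≡⟨ Σ<-distrib-+ (suc (suc m)) left right ⟩
  Σ< (suc (suc m)) left + Σ< (suc (suc m)) right
    ≡⟨ cong₂ _+_ differentiateLeft differentiateRight ⟩
  (∂ f ⊛ g) m + (f ⊛ ∂ g) m
    ∎
  where
  open ≡-Reasoning
  left right : ℕ → ℚ
  left  i = ι i * (f i * g (suc m ∸ i))
  right i = ι (suc m ∸ i) * (f i * g (suc m ∸ i))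

  splitWeight : ∀ i → i < suc (suc m) → ι (suc m) * (f i * g (suc m ∸ i)) ≡ left i + right i
  splitWeight i i<2+m = begin
    ι (suc m) * fg                   ≡⟨ cong (λ n → ι n * fg) (ℕₚ.m+[n∸m]≡n (ℕₚ.≤-pred i<2+m)) ⟨
    ι (i ℕ.+ (suc m ∸ i)) * fg       ≡⟨ cong (_* fg) (ι-homo-+ i (suc m ∸ i)) ⟩
    (ι i + ι (suc m ∸ i)) * fg       ≡⟨ ℚₚ.*-distribʳ-+ fg (ι i) (ι (suc m ∸ i)) ⟩
    left i + right i                 ∎
    where fg = f i * g (suc m ∸ i)

  differentiateLeft : Σ< (suc (suc m)) left ≡ (∂ f ⊛ g) m
  differentiateLeft = begin
    Σ< (suc (suc m)) left                                ≡⟨ Σ<-head (suc m) left ⟩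
    0ℚ * (f 0 * g (suc m)) + Σ< (suc m) (λ i → left (suc i))
      ≡⟨ cong₂ _+_ (ℚₚ.*-zeroˡ (f 0 * g (suc m)))
                   (Σ<-cong (suc m) (λ i → sym (ℚₚ.*-assoc (ι (suc i)) _ _))) ⟩
    0ℚ + (∂ f ⊛ g) m                                     ≡⟨ ℚₚ.+-identityˡ _ ⟩
    (∂ f ⊛ g) m                                          ∎

  differentiateRight : Σ< (suc (suc m)) right ≡ (f ⊛ ∂ g) m
  differentiateRight = begin
    Σ< (suc m) right + ι (m ∸ m) * (f (suc m) * g (m ∸ m))
      ≡⟨ cong (λ n → Σ< (suc m) right + ι n * (f (suc m) * g n)) (ℕₚ.n∸n≡0 m) ⟩
    Σ< (suc m) right + 0ℚ * (f (suc m) * g 0)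
      ≡⟨ trans (cong (_+_ (Σ< (suc m) right)) (ℚₚ.*-zeroˡ (f (suc m) * g 0)))
               (ℚₚ.+-identityʳ _) ⟩
    Σ< (suc m) right
      ≡⟨ Σ<-cong-< (suc m) (λ i i<1+m →
           trans (cong (λ n → ι n * (f i * g n)) (ℕₚ.+-∸-assoc 1 (ℕₚ.≤-pred i<1+m)))
                 (solve 3 (λ x y z → x :* (y :* z) := y :* (x :* z))
                        refl (ι (suc (m ∸ i))) (f i) (g (suc (m ∸ i))))) ⟩
    (f ⊛ ∂ g) m ∎

∂-unique : ∀ c {h h′ f f′} → h ≗ h′ → f 0 ≡ f′ 0 →
           ∂ f ≗ c ⊙ (h ⊕ f) → ∂ f′ ≗ c ⊙ (h′ ⊕ f′) → f ≗ f′
∂-unique c h≗h′ f₀≡f′₀ ∂f ∂f′ zero    = f₀≡f′₀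
∂-unique c {h} {h′} {f} {f′} h≗h′ f₀≡f′₀ ∂f ∂f′ (suc m) = *-cancelʳ-ι (suc m) (begin
  f (suc m) * ι (suc m)    ≡⟨ ℚₚ.*-comm (f (suc m)) _ ⟩
  ∂ f m                    ≡⟨ ∂f m ⟩
  c * (h m + f m)          ≡⟨ cong₂ (λ x y → c * (x + y)) (h≗h′ m)
                                     (∂-unique c h≗h′ f₀≡f′₀ ∂f ∂f′ m) ⟩
  c * (h′ m + f′ m)        ≡⟨ ∂f′ m ⟨
  ∂ f′ m                   ≡⟨ ℚₚ.*-comm _ (f′ (suc m)) ⟩
  f′ (suc m) * ι (suc m)   ∎)
  where open ≡-Reasoning

infix 30 _^⊛_
infix 24 _∘ₛ_

_^⊛_ : PowerSeries → ℕ → PowerSeries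
f ^⊛ zero  = one
f ^⊛ suc k = f ⊛ f ^⊛ k

-- f(g(t)), with the sum cut off at k = n: this is the composition only when g 0 ≡ 0ℚ, which makes
-- g ^⊛ k start at tᵏ.
_∘ₛ_ : PowerSeries → PowerSeries → PowerSeries
(f ∘ₛ g) n = Σ< (suc n) (λ k → f k * (g ^⊛ k) n)

^⊛-+ : ∀ g a b → g ^⊛ (a ℕ.+ b) ≗ g ^⊛ a ⊛ g ^⊛ b
^⊛-+ g zero    b n = sym (⊛-identityˡ (g ^⊛ b) n)
^⊛-+ g (suc a) b n = begin
  (g ⊛ g ^⊛ (a ℕ.+ b)) n      ≡⟨ ⊛-congˡ {g} (^⊛-+ g a b) n ⟩
  (g ⊛ (g ^⊛ a ⊛ g ^⊛ b)) n   ≡⟨ ⊛-assoc g (g ^⊛ a) (g ^⊛ b) n ⟨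
  ((g ⊛ g ^⊛ a) ⊛ g ^⊛ b) n   ∎
  where open ≡-Reasoning

∘ₛ-congˡ : ∀ {f f′} g → f ≗ f′ → f ∘ₛ g ≗ f′ ∘ₛ g
∘ₛ-congˡ g f≗f′ n = Σ<-cong (suc n) (λ k → cong (_* (g ^⊛ k) n) (f≗f′ k))

∘ₛ-⊕ : ∀ f h g → (f ⊕ h) ∘ₛ g ≗ f ∘ₛ g ⊕ h ∘ₛ g
∘ₛ-⊕ f h g n =
  trans (Σ<-cong (suc n) (λ k → ℚₚ.*-distribʳ-+ ((g ^⊛ k) n) (f k) (h k))) (Σ<-distrib-+ (suc n) _ _)

one-∘ₛ : ∀ g → one ∘ₛ g ≗ one
one-∘ₛ g n = trans (Σ<-head-only n (λ k → ℚₚ.*-zeroˡ ((g ^⊛ suc k) n))) (ℚₚ.*-identityˡ (one n))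

module _ (g : PowerSeries) (g₀≡0 : g 0 ≡ 0ℚ) where

  ^⊛-vanish : ∀ k n → n < k → (g ^⊛ k) n ≡ 0ℚ
  ^⊛-vanish (suc k) zero    _         =
    trans (ℚₚ.+-identityˡ _) (trans (cong (_* (g ^⊛ k) 0) g₀≡0) (ℚₚ.*-zeroˡ ((g ^⊛ k) 0)))
  ^⊛-vanish (suc k) (suc n) (s≤s n<k) = begin
    (g ⊛ g ^⊛ k) (suc n)
      ≡⟨ Σ<-head (suc n) _ ⟩
    g 0 * (g ^⊛ k) (suc n) + Σ< (suc n) (λ i → g (suc i) * (g ^⊛ k) (n ∸ i))
      ≡⟨ cong₂ _+_ (trans (cong (_* (g ^⊛ k) (suc n)) g₀≡0) (ℚₚ.*-zeroˡ ((g ^⊛ k) (suc n))))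
                   (Σ<-zero (suc n) (λ i _ → trans (cong (g (suc i) *_) (lowOrder i))
                                                    (ℚₚ.*-zeroʳ (g (suc i))))) ⟩
    0ℚ + 0ℚ
      ≡⟨⟩
    0ℚ
      ∎
    where
    open ≡-Reasoning
    lowOrder : ∀ i → (g ^⊛ k) (n ∸ i) ≡ 0ℚ
    lowOrder i = ^⊛-vanish k (n ∸ i) (ℕₚ.≤-<-trans (ℕₚ.m∸n≤m n i) n<k)

  ∘ₛ-extend : ∀ f {n N} → n < N → Σ< N (λ k → f k * (g ^⊛ k) n) ≡ (f ∘ₛ g) n
  ∘ₛ-extend f n<N =
    Σ<-extend _ n<N (λ k n<k → trans (cong (f k *_) (^⊛-vanish k _ n<k)) (ℚₚ.*-zeroʳ (f k)))

  X-∘ₛ : X· one ∘ₛ g ≗ g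
  X-∘ₛ zero    = sym g₀≡0
  X-∘ₛ (suc n) = begin
    (X· one ∘ₛ g) (suc n)
      ≡⟨ Σ<-head (suc n) _ ⟩
    0ℚ * (g ^⊛ 0) (suc n) + Σ< (suc n) (λ k → one k * (g ^⊛ suc k) (suc n))
      ≡⟨ cong₂ _+_ (ℚₚ.*-zeroˡ ((g ^⊛ 0) (suc n)))
                   (Σ<-head-only n {λ k → one k * (g ^⊛ suc k) (suc n)}
                                   (λ k → ℚₚ.*-zeroˡ ((g ^⊛ suc (suc k)) (suc n)))) ⟩
    0ℚ + 1ℚ * (g ⊛ one) (suc n)
      ≡⟨ trans (ℚₚ.+-identityˡ _) (ℚₚ.*-identityˡ _) ⟩
    (g ⊛ one) (suc n)
      ≡⟨ ⊛-identityʳ g (suc n) ⟩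
    g (suc n)
      ∎
    where open ≡-Reasoning

  -- Both sides equal the square sum Σ_{a,b ≤ m} f a · h b · [tᵐ] g^(a+b).
  ∘ₛ-⊛ : ∀ f h → (f ⊛ h) ∘ₛ g ≗ f ∘ₛ g ⊛ h ∘ₛ g
  ∘ₛ-⊛ f h m = trans expandLeft (sym expandRight)
    where
    open ≡-Reasoning
    N = suc m
    G : ℕ → ℕ → ℚ
    G a b = f a * h b * (g ^⊛ (a ℕ.+ b)) m

    beyondDiagonal : ∀ {a b} → a < N → N ∸ a ≤ b → m < a ℕ.+ b
    beyondDiagonal {a} a<N N∸a≤b =
      ℕₚ.≤-trans (ℕₚ.≤-reflexive (sym (ℕₚ.m+[n∸m]≡n (ℕₚ.<⇒≤ a<N)))) (ℕₚ.+-monoʳ-≤ a N∸a≤b)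

    expandLeft : ((f ⊛ h) ∘ₛ g) m ≡ Σ< N (λ a → Σ< N (G a))
    expandLeft = begin
      Σ< N (λ k → (f ⊛ h) k * (g ^⊛ k) m)
        ≡⟨ Σ<-cong N (λ k → Σ<-distribʳ-* (suc k) ((g ^⊛ k) m) _) ⟩
      Σ< N (λ k → Σ< (suc k) (λ a → f a * h (k ∸ a) * (g ^⊛ k) m))
        ≡⟨ Σ<-cong N (λ k → Σ<-cong-< (suc k) (λ a a<1+k →
             cong (λ l → f a * h (k ∸ a) * (g ^⊛ l) m) (sym (ℕₚ.m+[n∸m]≡n (ℕₚ.≤-pred a<1+k))))) ⟩
      Σ< N (λ k → Σ< (suc k) (λ a → G a (k ∸ a)))
        ≡⟨ Σ<-triangle N G ⟩
      Σ< N (λ a → Σ< (N ∸ a) (G a))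
        ≡⟨ Σ<-cong-< N (λ a a<N → sym (Σ<-extend (G a) (ℕₚ.m∸n≤m N a) (λ b N∸a≤b →
             trans (cong (f a * h b *_) (^⊛-vanish (a ℕ.+ b) m (beyondDiagonal a<N N∸a≤b)))
                   (ℚₚ.*-zeroʳ (f a * h b))))) ⟩
      Σ< N (λ a → Σ< N (G a))
        ∎

    term : ℕ → ℕ → ℕ → ℚ
    term a j b = f a * (g ^⊛ a) j * (h b * (g ^⊛ b) (m ∸ j))

    expandRight : (f ∘ₛ g ⊛ h ∘ₛ g) m ≡ Σ< N (λ a → Σ< N (G a))
    expandRight = begin
      Σ< N (λ j → (f ∘ₛ g) j * (h ∘ₛ g) (m ∸ j))
        ≡⟨ Σ<-cong-< N (λ j j<N →
             sym (cong₂ _*_ (∘ₛ-extend f j<N) (∘ₛ-extend h (s≤s (ℕₚ.m∸n≤m m j))))) ⟩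
      Σ< N (λ j → Σ< N (λ a → f a * (g ^⊛ a) j) * Σ< N (λ b → h b * (g ^⊛ b) (m ∸ j)))
        ≡⟨ Σ<-cong N (λ j → Σ<-*-Σ< N N _ _) ⟩
      Σ< N (λ j → Σ< N (λ a → Σ< N (term a j)))
        ≡⟨ Σ<-swap N N _ ⟩
      Σ< N (λ a → Σ< N (λ j → Σ< N (term a j)))
        ≡⟨ Σ<-cong N (λ a → Σ<-swap N N (term a)) ⟩
      Σ< N (λ a → Σ< N (λ b → Σ< N (λ j → term a j b)))
        ≡⟨ Σ<-cong N (λ a → Σ<-cong N (λ b → trans
             (Σ<-cong N (λ j → solve 4 (λ p w q v → p :* w :* (q :* v) := p :* q :* (w :* v))
                                        refl (f a) ((g ^⊛ a) j) (h b) ((g ^⊛ b) (m ∸ j))))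
             (sym (Σ<-distribˡ-* N (f a * h b) _)))) ⟩
      Σ< N (λ a → Σ< N (λ b → f a * h b * (g ^⊛ a ⊛ g ^⊛ b) m))
        ≡⟨ Σ<-cong N (λ a → Σ<-cong N (λ b → cong (f a * h b *_) (sym (^⊛-+ g a b m)))) ⟩
      Σ< N (λ a → Σ< N (G a))
        ∎

  X·-∘ₛ : ∀ f → (X· f) ∘ₛ g ≗ g ⊛ f ∘ₛ g
  X·-∘ₛ f = begin
    (X· f) ∘ₛ g            ≈⟨ ∘ₛ-congˡ g X·-as-⊛ ⟩
    (X· one ⊛ f) ∘ₛ g      ≈⟨ ∘ₛ-⊛ (X· one) f ⟩
    X· one ∘ₛ g ⊛ f ∘ₛ g   ≈⟨ ⊛-congʳ {g = f ∘ₛ g} X-∘ₛ ⟩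
    g ⊛ f ∘ₛ g             ∎
    where
    open ≗-Reasoning
    X·-as-⊛ : X· f ≗ X· one ⊛ f
    X·-as-⊛ zero    = sym (X·-⊛ one f zero)
    X·-as-⊛ (suc n) = sym (trans (X·-⊛ one f (suc n)) (⊛-identityˡ f n))

expm1 : PowerSeries
expm1 = X· expm1/t

∂-expm1 : ∂ expm1 ≗ one ⊕ expm1
∂-expm1 zero    = refl
∂-expm1 (suc n) = trans (ι[1+n]*1/[1+n]!≡1/n! (suc n)) (sym (ℚₚ.+-identityˡ (expm1 (suc n))))

module _ {g : PowerSeries} (∂g≗1+g : ∂ g ≗ one ⊕ g) where

  ∂-^⊛ : ∀ k → ∂ (g ^⊛ suc k) ≗ ι (suc k) ⊙ (g ^⊛ k ⊕ g ^⊛ suc k)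
  ∂-^⊛ zero = begin
    ∂ (g ⊛ one)             ≈⟨ ∂-cong (⊛-identityʳ g) ⟩
    ∂ g                     ≈⟨ ∂g≗1+g ⟩
    one ⊕ g                 ≈⟨ (λ n → trans (ℚₚ.*-identityˡ _) (cong (_+_ (one n)) (⊛-identityʳ g n))) ⟨
    ι 1 ⊙ (one ⊕ g ⊛ one)   ∎
    where open ≗-Reasoning
  ∂-^⊛ (suc k) = begin
    ∂ (g ⊛ G₁)                                     ≈⟨ ∂-⊛ g G₁ ⟩
    ∂ g ⊛ G₁ ⊕ g ⊛ ∂ G₁                            ≈⟨ ⊕-cong (⊛-congʳ {g = G₁} ∂g≗1+g)
                                                              (⊛-congˡ {g} (∂-^⊛ k)) ⟩
    (one ⊕ g) ⊛ G₁ ⊕ g ⊛ (ι (suc k) ⊙ (G₀ ⊕ G₁))   ≈⟨ ⊕-cong expandLeft expandRight ⟩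
    (G₁ ⊕ G₂) ⊕ ι (suc k) ⊙ (G₁ ⊕ G₂)              ≈⟨ (λ n → solve 3 (λ c x y → (x :+ y) :+ c :* (x :+ y)
                                                                            := (con 1ℚ :+ c) :* (x :+ y))
                                                                refl (ι (suc k)) (G₁ n) (G₂ n)) ⟩
    (1ℚ + ι (suc k)) ⊙ (G₁ ⊕ G₂)                   ≈⟨ (λ n → cong (_* (G₁ n + G₂ n)) (ι-suc (suc k))) ⟨
    ι (suc (suc k)) ⊙ (G₁ ⊕ G₂)                    ∎
    where
    open ≗-Reasoning
    G₀ G₁ G₂ : PowerSeries
    G₀ = g ^⊛ k
    G₁ = g ^⊛ suc k
    G₂ = g ^⊛ suc (suc k)
    expandLeft : (one ⊕ g) ⊛ G₁ ≗ G₁ ⊕ G₂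
    expandLeft n = trans (⊛-distribʳ-⊕ one g G₁ n) (cong (_+ G₂ n) (⊛-identityˡ G₁ n))
    expandRight : g ⊛ (ι (suc k) ⊙ (G₀ ⊕ G₁)) ≗ ι (suc k) ⊙ (G₁ ⊕ G₂)
    expandRight n =
      trans (⊛-⊙ g (ι (suc k)) (G₀ ⊕ G₁) n) (cong (ι (suc k) *_) (⊛-distribˡ-⊕ g G₀ G₁ n))

signedFactorial : ℕ → ℚ
signedFactorial k = (-[1+ 0 ] / 1) ^ k * ι (k !)

signedFactorial-suc : ∀ k → signedFactorial k * ι (suc k) ≡ - signedFactorial (suc k)
signedFactorial-suc k = begin
  s * ι (k !) * ι (suc k)
    ≡⟨ solve 3 (λ s f n → s :* f :* n := :- (con (-[1+ 0 ] / 1) :* s :* (n :* f))) refl s (ι (k !)) (ι (suc k)) ⟩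
  - ((-[1+ 0 ] / 1) ^ suc k * (ι (suc k) * ι (k !)))
    ≡⟨ cong (λ x → - ((-[1+ 0 ] / 1) ^ suc k * x)) (ι-homo-* (suc k) (k !)) ⟨
  - signedFactorial (suc k)
    ∎
  where
  open ≡-Reasoning
  s = (-[1+ 0 ] / 1) ^ k

log1p/t*ι[[1+k]!]≡signedFactorial : ∀ k → log1p/t k * ι (suc k !) ≡ signedFactorial k
log1p/t*ι[[1+k]!]≡signedFactorial zero    = refl
log1p/t*ι[[1+k]!]≡signedFactorial (suc k) = begin
  s * r * ι (suc (suc k) !)                  ≡⟨ cong (s * r *_) (ι-homo-* (suc (suc k)) (suc k !)) ⟩
  s * r * (ι (suc (suc k)) * ι (suc k !))    ≡⟨ solve 4 (λ s i n f → s :* i :* (n :* f) := s :* (n :* i) :* f)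
                                                       refl s r (ι (suc (suc k))) (ι (suc k !)) ⟩
  s * (ι (suc (suc k)) * r) * ι (suc k !)    ≡⟨ cong (λ x → s * x * ι (suc k !)) (ι[n]*1/n≡1 (suc (suc k))) ⟩
  s * 1ℚ * ι (suc k !)                       ≡⟨ cong (_* ι (suc k !)) (ℚₚ.*-identityʳ s) ⟩
  signedFactorial (suc k)                    ∎
  where
  open ≡-Reasoning
  s r : ℚ
  s = (-[1+ 0 ] / 1) ^ suc k
  r = (+ 1) / suc (suc k)

module Stirling {S : ℕ → ℕ → ℚ} (isStirling : IsStirling₂ S) where

  powers : ∀ n x → x ^ n ≡ Σ< (suc n) (λ k → S n k * fall x k)
  powers = proj₁ isStirling

  S-vanish : ∀ n k → n < k → S n k ≡ 0ℚ
  S-vanish = proj₂ isStirling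

  S-zero-zero : S 0 0 ≡ 1ℚ
  S-zero-zero = sym (trans (powers 0 0ℚ) (solve 1 (λ s → con 0ℚ :+ s :* con 1ℚ := s) refl (S 0 0)))

  -- The right-hand side of S(n+1,k) = S(n,k−1) + k·S(n,k).
  recurrence : ℕ → ℕ → ℚ
  recurrence n zero    = 0ℚ
  recurrence n (suc k) = S n k + ι (suc k) * S n (suc k)

  -- Uses x · x^(k falling) = x^(k+1 falling) + k · x^(k falling).
  x*-falling-expansion : ∀ n x → Σ< (suc (suc n)) (λ k → recurrence n k * fall x k)
                                 ≡ x * Σ< (suc n) (λ k → S n k * fall x k)
  x*-falling-expansion n x = begin
    Σ< (suc (suc n)) (λ k → recurrence n k * fall x k)
      ≡⟨ trans (Σ<-head (suc n) _) (ℚₚ.+-identityˡ _) ⟩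
    Σ< (suc n) (λ k → (S n k + ι (suc k) * S n (suc k)) * fall x (suc k))
      ≡⟨ Σ<-cong (suc n) (λ k → ℚₚ.*-distribʳ-+ (fall x (suc k)) (S n k) _) ⟩
    Σ< (suc n) (λ k → raised k + g (suc k))
      ≡⟨ Σ<-distrib-+ (suc n) _ _ ⟩
    Σ< (suc n) raised + Σ< (suc n) (λ k → g (suc k))
      ≡⟨ cong (_+_ (Σ< (suc n) raised)) reindex ⟩
    Σ< (suc n) raised + Σ< (suc n) g
      ≡⟨ Σ<-distrib-+ (suc n) _ _ ⟨
    Σ< (suc n) (λ k → raised k + g k)
      ≡⟨ Σ<-cong (suc n) (λ k → solve 4 (λ s f y i → s :* (f :* (y :- i)) :+ i :* s :* f := y :* (s :* f))
                                         refl (S n k) (fall x k) x (ι k)) ⟩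
    Σ< (suc n) (λ k → x * (S n k * fall x k))
      ≡⟨ Σ<-distribˡ-* (suc n) x _ ⟨
    x * Σ< (suc n) (λ k → S n k * fall x k)
      ∎
    where
    open ≡-Reasoning
    raised g : ℕ → ℚ
    raised k = S n k * fall x (suc k)
    g k = ι k * S n k * fall x k
    reindex : Σ< (suc n) (λ k → g (suc k)) ≡ Σ< (suc n) g
    reindex = begin
      Σ< (suc n) (λ k → g (suc k))
        ≡⟨ ℚₚ.+-identityˡ _ ⟨
      0ℚ + Σ< (suc n) (λ k → g (suc k))
        ≡⟨ cong (_+ Σ< (suc n) (λ k → g (suc k)))
                (solve 1 (λ s → con 0ℚ :* s :* con 1ℚ := con 0ℚ) refl (S n 0)) ⟨
      g 0 + Σ< (suc n) (λ k → g (suc k))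
        ≡⟨ Σ<-head (suc n) g ⟨
      Σ< (suc n) g + ι (suc n) * S n (suc n) * fall x (suc n)
        ≡⟨ cong (λ s → Σ< (suc n) g + ι (suc n) * s * fall x (suc n)) (S-vanish n (suc n) (ℕₚ.n<1+n n)) ⟩
      Σ< (suc n) g + ι (suc n) * 0ℚ * fall x (suc n)
        ≡⟨ solve 3 (λ a b c → a :+ b :* con 0ℚ :* c := a) refl (Σ< (suc n) g) (ι (suc n)) (fall x (suc n)) ⟩
      Σ< (suc n) g
        ∎

  S-suc : ∀ n k → k < suc (suc n) → S (suc n) k ≡ recurrence n k
  S-suc n k k<2+n = x∙y⁻¹≈ε⇒x≈y (S (suc n) k) (recurrence n k)
    (fall-coefficients-unique (suc (suc n)) (λ k → S (suc n) k - recurrence n k) sameExpansion k k<2+n)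
    where
    open ≡-Reasoning
    N = suc (suc n)
    sameExpansion : ∀ x → Σ< N (λ k → (S (suc n) k - recurrence n k) * fall x k) ≡ 0ℚ
    sameExpansion x = begin
      Σ< N (λ k → (S (suc n) k - recurrence n k) * fall x k)
        ≡⟨ Σ<-cong N (λ k → solve 3 (λ a b c → (a :- b) :* c := a :* c :- b :* c)
                                     refl (S (suc n) k) (recurrence n k) (fall x k)) ⟩
      Σ< N (λ k → S (suc n) k * fall x k - recurrence n k * fall x k)
        ≡⟨ Σ<-distrib-- N _ _ ⟩
      Σ< N (λ k → S (suc n) k * fall x k) - Σ< N (λ k → recurrence n k * fall x k)
        ≡⟨ cong₂ _-_ (powers (suc n) x) (trans (cong (x *_) (powers n x)) (sym (x*-falling-expansion n x))) ⟨
      x * x ^ n - x * x ^ n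
        ≡⟨ ℚₚ.+-inverseʳ (x * x ^ n) ⟩
      0ℚ
        ∎

  S-suc-zero : ∀ n → S (suc n) 0 ≡ 0ℚ
  S-suc-zero n = S-suc n 0 (s≤s z≤n)

  S-suc-suc : ∀ n k → S (suc n) (suc k) ≡ S n k + ι (suc k) * S n (suc k)
  S-suc-suc n k with k ℕ.≤? n
  ... | yes k≤n = S-suc n (suc k) (s≤s (s≤s k≤n))
  ... | no  k≰n = begin
    S (suc n) (suc k)                 ≡⟨ S-vanish (suc n) (suc k) (s≤s n<k) ⟩
    0ℚ                                ≡⟨ solve 1 (λ i → con 0ℚ := con 0ℚ :+ i :* con 0ℚ) refl (ι (suc k)) ⟩
    0ℚ + ι (suc k) * 0ℚ               ≡⟨ cong₂ (λ a b → a + ι (suc k) * b)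
                                               (S-vanish n k n<k) (S-vanish n (suc k) (ℕₚ.m<n⇒m<1+n n<k)) ⟨
    S n k + ι (suc k) * S n (suc k)   ∎
    where
    open ≡-Reasoning
    n<k = ℕₚ.≰⇒> k≰n

  stirlingEgf : ℕ → PowerSeries
  stirlingEgf k = egf (λ n → ι (k !) * S n k)

  stirlingEgf-vanish : ∀ {k n} → S n k ≡ 0ℚ → stirlingEgf k n ≡ 0ℚ
  stirlingEgf-vanish {k} {n} S≡0 = begin
    ι (k !) * S n k * 1/ n !   ≡⟨ cong (λ s → ι (k !) * s * 1/ n !) S≡0 ⟩
    ι (k !) * 0ℚ * 1/ n !      ≡⟨ solve 2 (λ a b → a :* con 0ℚ :* b := con 0ℚ) refl (ι (k !)) (1/ n !) ⟩
    0ℚ                         ∎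
    where open ≡-Reasoning

  ∂-stirlingEgf : ∀ k → ∂ (stirlingEgf (suc k)) ≗ ι (suc k) ⊙ (stirlingEgf k ⊕ stirlingEgf (suc k))
  ∂-stirlingEgf k m = begin
    ι (suc m) * (ι (suc k !) * S (suc m) (suc k) * 1/ suc m !)
      ≡⟨ solve 4 (λ a b c d → a :* (b :* c :* d) := b :* c :* (a :* d))
               refl (ι (suc m)) (ι (suc k !)) (S (suc m) (suc k)) (1/ suc m !) ⟩
    ι (suc k !) * S (suc m) (suc k) * (ι (suc m) * 1/ suc m !)
      ≡⟨ cong₂ (λ a c → a * S (suc m) (suc k) * c) (ι-homo-* (suc k) (k !)) (ι[1+n]*1/[1+n]!≡1/n! m) ⟩
    ι (suc k) * ι (k !) * S (suc m) (suc k) * 1/ m !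
      ≡⟨ cong (λ b → ι (suc k) * ι (k !) * b * 1/ m !) (S-suc-suc m k) ⟩
    ι (suc k) * ι (k !) * (S m k + ι (suc k) * S m (suc k)) * 1/ m !
      ≡⟨ solve 5 (λ a b c d e → a :* b :* (c :+ a :* d) :* e := a :* (b :* c :* e :+ (a :* b) :* d :* e))
               refl (ι (suc k)) (ι (k !)) (S m k) (S m (suc k)) (1/ m !) ⟩
    ι (suc k) * (ι (k !) * S m k * 1/ m ! + ι (suc k) * ι (k !) * S m (suc k) * 1/ m !)
      ≡⟨ cong (λ a → ι (suc k) * (ι (k !) * S m k * 1/ m ! + a * S m (suc k) * 1/ m !))
              (ι-homo-* (suc k) (k !)) ⟨
    ι (suc k) * (stirlingEgf k m + stirlingEgf (suc k) m)
      ∎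
    where open ≡-Reasoning

  -- Both sides solve ∂ Fₖ₊₁ = (k+1)(Fₖ + Fₖ₊₁) with Fₖ₊₁ 0 = 0.
  expm1^⊛≗stirlingEgf : ∀ k → expm1 ^⊛ k ≗ stirlingEgf k
  expm1^⊛≗stirlingEgf zero    zero    = sym (cong (λ s → ι 1 * s * 1/ 0 !) S-zero-zero)
  expm1^⊛≗stirlingEgf zero    (suc n) = sym (stirlingEgf-vanish (S-suc-zero n))
  expm1^⊛≗stirlingEgf (suc k)         = ∂-unique (ι (suc k)) (expm1^⊛≗stirlingEgf k)
    (trans (^⊛-vanish expm1 refl (suc k) 0 (s≤s z≤n)) (sym (stirlingEgf-vanish (S-vanish 0 (suc k) (s≤s z≤n)))))
    (∂-^⊛ ∂-expm1 k) (∂-stirlingEgf k)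

  Σ<-signedFactorial*S : ∀ m → Σ< (suc m) (λ k → signedFactorial k * S (suc m) (suc k)) ≡ S m 0
  Σ<-signedFactorial*S m = begin
    Σ< (suc m) (λ k → signedFactorial k * S (suc m) (suc k))
      ≡⟨ Σ<-cong (suc m) telescopic ⟩
    Σ< (suc m) (λ k → u k - u (suc k))
      ≡⟨ Σ<-telescope (suc m) u ⟩
    u 0 - signedFactorial (suc m) * S m (suc m)
      ≡⟨ cong (λ s → u 0 - signedFactorial (suc m) * s) (S-vanish m (suc m) (ℕₚ.n<1+n m)) ⟩
    u 0 - signedFactorial (suc m) * 0ℚ
      ≡⟨ solve 2 (λ s σ → con 1ℚ :* con 1ℚ :* s :- σ :* con 0ℚ := s)
               refl (S m 0) (signedFactorial (suc m)) ⟩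
    S m 0
      ∎
    where
    open ≡-Reasoning
    u : ℕ → ℚ
    u k = signedFactorial k * S m k
    telescopic : ∀ k → signedFactorial k * S (suc m) (suc k) ≡ u k - u (suc k)
    telescopic k = begin
      signedFactorial k * S (suc m) (suc k)
        ≡⟨ cong (signedFactorial k *_) (S-suc-suc m k) ⟩
      signedFactorial k * (S m k + ι (suc k) * S m (suc k))
        ≡⟨ solve 4 (λ σ a i b → σ :* (a :+ i :* b) := σ :* a :+ σ :* i :* b)
                 refl (signedFactorial k) (S m k) (ι (suc k)) (S m (suc k)) ⟩
      u k + signedFactorial k * ι (suc k) * S m (suc k)
        ≡⟨ cong (λ σ → u k + σ * S m (suc k)) (signedFactorial-suc k) ⟩
      u k + - signedFactorial (suc k) * S m (suc k)
        ≡⟨ cong (_+_ (u k)) (ℚₚ.neg-distribˡ-* (signedFactorial (suc k)) (S m (suc k))) ⟨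
      u k - u (suc k)
        ∎

  log∘expm1 : (X· log1p/t) ∘ₛ expm1 ≗ X· one
  log∘expm1 zero    = refl
  log∘expm1 (suc m) = begin
    ((X· log1p/t) ∘ₛ expm1) (suc m)
      ≡⟨ Σ<-head (suc m) _ ⟩
    0ℚ * one (suc m) + Σ< (suc m) (λ k → log1p/t k * (expm1 ^⊛ suc k) (suc m))
      ≡⟨ cong₂ _+_ (ℚₚ.*-zeroˡ (one (suc m)))
                   (Σ<-cong (suc m) (λ k → cong (log1p/t k *_) (expm1^⊛≗stirlingEgf (suc k) (suc m)))) ⟩
    0ℚ + Σ< (suc m) (λ k → log1p/t k * (ι (suc k !) * S (suc m) (suc k) * 1/ suc m !))
      ≡⟨ ℚₚ.+-identityˡ _ ⟩
    Σ< (suc m) (λ k → log1p/t k * (ι (suc k !) * S (suc m) (suc k) * 1/ suc m !))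
      ≡⟨ Σ<-cong (suc m) signed ⟩
    Σ< (suc m) (λ k → signedFactorial k * S (suc m) (suc k) * 1/ suc m !)
      ≡⟨ Σ<-distribʳ-* (suc m) (1/ suc m !) _ ⟨
    Σ< (suc m) (λ k → signedFactorial k * S (suc m) (suc k)) * 1/ suc m !
      ≡⟨ cong (_* 1/ suc m !) (Σ<-signedFactorial*S m) ⟩
    S m 0 * 1/ suc m !
      ≡⟨ S-zero-column m ⟩
    one m
      ∎
    where
    open ≡-Reasoning
    signed : ∀ k → log1p/t k * (ι (suc k !) * S (suc m) (suc k) * 1/ suc m !)
                   ≡ signedFactorial k * S (suc m) (suc k) * 1/ suc m !
    signed k = trans (solve 4 (λ l i s f → l :* (i :* s :* f) := l :* i :* s :* f)
                            refl (log1p/t k) (ι (suc k !)) (S (suc m) (suc k)) (1/ suc m !))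
                     (cong (λ σ → σ * S (suc m) (suc k) * 1/ suc m !) (log1p/t*ι[[1+k]!]≡signedFactorial k))
    S-zero-column : ∀ m → S m 0 * 1/ suc m ! ≡ one m
    S-zero-column zero    = cong (_* 1/ 1 !) S-zero-zero
    S-zero-column (suc m) = trans (cong (_* 1/ suc (suc m) !) (S-suc-zero m)) (ℚₚ.*-zeroˡ (1/ suc (suc m) !))

module Bernoulli {S : ℕ → ℕ → ℚ} (isStirling : IsStirling₂ S)
                 {B* : ℕ → ℚ} (isB* : IsBernoulli₂ B*) where
  open Stirling isStirling

  egf-B*∘expm1 : egf B* ∘ₛ expm1 ≗ expm1/t
  egf-B*∘expm1 = ⊛-inverse-unique {h = log1p/t ∘ₛ expm1} egfB*-inverse expm1/t-inverse
    where
    open ≗-Reasoning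
    egfB*-inverse : egf B* ∘ₛ expm1 ⊛ log1p/t ∘ₛ expm1 ≗ one
    egfB*-inverse = begin
      egf B* ∘ₛ expm1 ⊛ log1p/t ∘ₛ expm1   ≈⟨ ∘ₛ-⊛ expm1 refl (egf B*) log1p/t ⟨
      (egf B* ⊛ log1p/t) ∘ₛ expm1          ≈⟨ ∘ₛ-congˡ expm1 isB* ⟩
      one ∘ₛ expm1                         ≈⟨ one-∘ₛ expm1 ⟩
      one                                  ∎
    expm1/t-inverse : expm1/t ⊛ log1p/t ∘ₛ expm1 ≗ one
    expm1/t-inverse = X·-injective (begin
      X· (expm1/t ⊛ log1p/t ∘ₛ expm1)   ≈⟨ X·-⊛ expm1/t (log1p/t ∘ₛ expm1) ⟨
      expm1 ⊛ log1p/t ∘ₛ expm1          ≈⟨ X·-∘ₛ expm1 refl log1p/t ⟨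
      (X· log1p/t) ∘ₛ expm1             ≈⟨ log∘expm1 ⟩
      X· one                            ∎)

  bernoulli-egf-expansion : ∀ {B} → IsBernoulli B → egf B ⊕ X· ((egf B* /X) ∘ₛ expm1) ≗ one
  bernoulli-egf-expansion {B} isB = begin
    β ⊕ X· R                     ≈⟨ ⊕-cong (⊛-identityʳ β) (X·-cong (⊛-identityˡ R)) ⟨
    β ⊛ one ⊕ X· (one ⊛ R)       ≈⟨ ⊕-congˡ {β ⊛ one} (X·-cong (⊛-congʳ {g = R} isB)) ⟨
    β ⊛ one ⊕ X· ((β ⊛ E) ⊛ R)   ≈⟨ ⊕-congˡ {β ⊛ one} (X·-cong (⊛-assoc β E R)) ⟩
    β ⊛ one ⊕ X· (β ⊛ (E ⊛ R))   ≈⟨ ⊕-congˡ {β ⊛ one} (⊛-X· β (E ⊛ R)) ⟨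
    β ⊛ one ⊕ β ⊛ X· (E ⊛ R)     ≈⟨ ⊛-distribˡ-⊕ β one (X· (E ⊛ R)) ⟨
    β ⊛ (one ⊕ X· (E ⊛ R))       ≈⟨ ⊛-congˡ {β} expm1/t-expansion ⟨
    β ⊛ E                        ≈⟨ isB ⟩
    one                          ∎
    where
    open ≗-Reasoning
    β E R : PowerSeries
    β = egf B
    E = expm1/t
    R = (egf B* /X) ∘ₛ expm1

    B*₀≡1 : egf B* 0 ≡ 1ℚ
    B*₀≡1 = trans (solve 1 (λ p → p := con 0ℚ :+ p :* con 1ℚ) refl (egf B* 0)) (isB* 0)

    expm1/t-expansion : E ≗ one ⊕ X· (E ⊛ R)
    expm1/t-expansion = begin
      E                                          ≈⟨ egf-B*∘expm1 ⟨
      egf B* ∘ₛ expm1                            ≈⟨ ∘ₛ-congˡ expm1 (one⊕X·/X {egf B*} B*₀≡1) ⟩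
      (one ⊕ X· (egf B* /X)) ∘ₛ expm1            ≈⟨ ∘ₛ-⊕ one (X· (egf B* /X)) expm1 ⟩
      one ∘ₛ expm1 ⊕ (X· (egf B* /X)) ∘ₛ expm1   ≈⟨ ⊕-cong (one-∘ₛ expm1) (X·-∘ₛ expm1 refl (egf B* /X)) ⟩
      one ⊕ expm1 ⊛ R                            ≈⟨ ⊕-congˡ {one} (X·-⊛ E R) ⟩
      one ⊕ X· (E ⊛ R)                           ∎

  tail∘expm1-coefficient : ∀ m → ((egf B* /X) ∘ₛ expm1) m * ι (suc m !)
                                 ≡ Σ< (suc m) (λ j → (((+ (suc m)) / suc j) * S m j) * B* (suc j))
  tail∘expm1-coefficient m = trans (Σ<-distribʳ-* (suc m) (ι (suc m !)) _) (Σ<-cong (suc m) term)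
    where
    open ≡-Reasoning
    term : ∀ k → egf B* (suc k) * (expm1 ^⊛ k) m * ι (suc m !) ≡ (((+ (suc m)) / suc k) * S m k) * B* (suc k)
    term k = begin
      B* (suc k) * 1/ suc k ! * (expm1 ^⊛ k) m * ι (suc m !)
        ≡⟨ cong (λ w → B* (suc k) * 1/ suc k ! * w * ι (suc m !)) (expm1^⊛≗stirlingEgf k m) ⟩
      B* (suc k) * 1/ suc k ! * (ι (k !) * S m k * 1/ m !) * ι (suc m !)
        ≡⟨ solve 6 (λ b f i s g j → b :* f :* (i :* s :* g) :* j := b :* (f :* i) :* s :* (g :* j))
                 refl (B* (suc k)) (1/ suc k !) (ι (k !)) (S m k) (1/ m !) (ι (suc m !)) ⟩
      B* (suc k) * (1/ suc k ! * ι (k !)) * S m k * (1/ m ! * ι (suc m !))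
        ≡⟨ cong₂ (λ x y → B* (suc k) * x * S m k * y) (1/[1+k]!*ι[k!]≡1/[1+k] k) (1/m!*ι[[1+m]!]≡ι[1+m] m) ⟩
      B* (suc k) * ((+ 1) / suc k) * S m k * ι (suc m)
        ≡⟨ solve 4 (λ b v s n → b :* v :* s :* n := n :* v :* s :* b)
                 refl (B* (suc k)) ((+ 1) / suc k) (S m k) (ι (suc m)) ⟩
      ι (suc m) * ((+ 1) / suc k) * S m k * B* (suc k)
        ≡⟨ cong (λ x → x * S m k * B* (suc k)) (+a/n≡ι[a]*1/n (suc m) k) ⟨
      (((+ (suc m)) / suc k) * S m k) * B* (suc k)
        ∎

corollary1 : (B B* : ℕ → ℚ) (S : ℕ → ℕ → ℚ) →
    IsBernoulli B → IsBernoulli₂ B* → IsStirling₂ S →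
    (n : ℕ) → n ≥ 1 →
    B n ≡ - Σ< n (λ j → (((+ n) / suc j) * S (n ∸ 1) j) * B* (suc j))
corollary1 B B* S isB isB* isStirling (suc m) (s≤s z≤n) = begin
  B (suc m)                     ≡⟨ egf[a]n*ι[n!]≡a[n] B (suc m) ⟨
  egf B (suc m) * ι (suc m !)   ≡⟨ cong (_* ι (suc m !)) (inverseˡ-unique (egf B (suc m)) (R m)
                                                            (bernoulli-egf-expansion {B} isB (suc m))) ⟩
  - R m * ι (suc m !)           ≡⟨ ℚₚ.neg-distribˡ-* (R m) (ι (suc m !)) ⟨
  - (R m * ι (suc m !))         ≡⟨ cong -_ (tail∘expm1-coefficient m) ⟩
  - Σ< (suc m) (λ j → (((+ (suc m)) / suc j) * S m j) * B* (suc j))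
                                ∎
  where
  open ≡-Reasoning
  open Bernoulli isStirling {B*} isB*
  R : PowerSeries
  R = (egf B* /X) ∘ₛ expm1
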